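{- Let $n\ge 5$. The maximum of the total chord length $TCL(G)$ over all maximal outerplanar graphs $G$ of order $n$ equals \[ \frac{n^2-9}{4} \text{ if } n \text{ is odd},\qquad \frac{n^2-8}{4} \text{ if } n \text{ is even}. \]
   Context: A maximal outerplanar graph of order $n$ is regarded as a drawing consisting of an $n$-cycle $\mathcal{C}$ in the plane together with a triangulation (by non-crossing edges between vertices of $\mathcal{C}$) of the bounded region determined by $\mathcal{C}$; all $n$ vertices lie on $\mathcal{C}$. The edges not belonging to $\mathcal{C}$ are called chords (there are $n-3$ of them). The length of a chord is the length (number of edges) of a shortest path in $\mathcal{C}$ between its endpoints. The total chord length $TCL(G)$ is the sum of the lengths of all chords of $G$. -}

module Defs where

open import Data.Nat using (ℕ; zero; suc; _+_; _*_; _∸_; _≤_; _<_; _⊓_)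
open import Data.Nat.DivMod using (_/_; _%_)
open import Data.Product using (_×_; _,_; Σ; ∃)
open import Data.Sum using (_⊎_)
open import Data.List using (List; map)
open import Data.Nat.ListAction using (sum)
open import Data.List.Membership.Propositional using (_∈_)
open import Data.List.Relation.Unary.All using (All)
open import Data.List.Relation.Unary.Any using (Any)
open import Data.List.Relation.Unary.Unique.Propositional using (Unique)
open import Relation.Nullary using (¬_)
open import Relation.Binary.PropositionalEquality using (_≡_)

-- The n-cycle C has vertices 0,1,…,n-1 (in cyclic order), edges {i,i+1} and {n-1,0}.
-- A chord (diagonal) is a pair (i , j) with i < j ≤ n-1 that is not an edge of C,
-- i.e. j - i ≥ 2 and (i , j) ≠ (0 , n-1).  Each chord is stored once, smaller end first.
Chord : ℕ → ℕ × ℕ → Set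
Chord n (i , j) = (2 + i ≤ j) × (j < n) × ¬ (i ≡ 0 × suc j ≡ n)

-- Two chords (drawn as straight segments inside the convex n-gon) cross
-- iff their endpoints strictly interleave along the cycle.
Cross : ℕ × ℕ → ℕ × ℕ → Set
Cross (a , b) (c , d) = (a < c × c < b × b < d) ⊎ (c < a × a < d × d < b)

record Triangulation (n : ℕ) : Set where
  field
    chords     : List (ℕ × ℕ)
    allChords  : All (Chord n) chords
    distinct   : Unique chords
    noncross   : ∀ {e f} → e ∈ chords → f ∈ chords → ¬ Cross e f
    maximal    : ∀ e → Chord n e → ¬ (e ∈ chords) → Any (Cross e) chords
open Triangulation public

-- The maximal outerplanar graph of order n: the cycle C plus the chords of a triangulation.
MOP : ℕ → Set
MOP = Triangulation

-- Length of chord (i , j): shortest path in C between i and j.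
chordLength : ℕ → ℕ × ℕ → ℕ
chordLength n (i , j) = (j ∸ i) ⊓ (n ∸ (j ∸ i))

TCL : {n : ℕ} → MOP n → ℕ
TCL {n} G = sum (map (chordLength n) (chords G))

maxTCL : ℕ → ℕ
maxTCL n with n % 2
... | zero  = (n * n ∸ 8) / 4
... | suc _ = (n * n ∸ 9) / 4

-- Layer cake: TCL G = Σ_{m<n} ℓ_m, where ℓ_m is the number of chords of G longer than m.
-- A chord (i , j), i < j, is longer than m iff its span j − i lies in [m + 1 , n − m − 1].
-- Chords with span in [m′ , U] inside a window [a , b] of width S number at most
-- (S ⊓ U) + 1 − m′: split the window at the far end t of the longest chord from a that
-- stops short of b; non-crossing puts every chord of the window other than (a , b) into
-- [a , t] or [t , b], and the bound is superadditive in the widths of the two halves, with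
-- room to spare for (a , b) itself when S ≤ U.
-- Hence ℓ_m ≤ n − 1 − 2m for m ≥ 1, while ℓ₀ = ℓ₁ ≤ n − 3 since chords have length ≥ 2, so
-- TCL G + 2 ≤ Σ_{m<n} (n − 1 − 2m)⁺ = ⌊n²/4⌋.  The fan at vertex 0 attains this: its
-- TCL + 2 is Σ_{j<n} min(j , n − j).  This sum and ⌊n²/4⌋ both satisfy f (n + 2) = f n + n + 1
-- and agree at n = 0, 1; for n ≥ 3 so does maxTCL n + 2, agreeing with ⌊n²/4⌋ at n = 3, 4.
module Submission where

open import Defs
open import Data.Nat using (ℕ; zero; suc; pred; _+_; _*_; _∸_; _≤_; _<_; _⊓_; z≤n; s≤s; z<s; _≤?_; _<?_; _≟_)
open import Data.Nat.Properties
open import Data.Nat.DivMod using (_/_; _%_; m*n/n≡m; +-distrib-/-∣ʳ)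
open import Data.Nat.Divisibility using (divides)
open import Data.Nat.Induction using (<-rec)
open import Data.Nat.ListAction using (sum)
open import Data.Nat.ListAction.Properties using (sum-++)
open import Data.Nat.Tactic.RingSolver using (solve-∀)
open import Data.Product using (Σ; ∃; _×_; _,_; proj₂)
open import Data.Product.Properties using (≡-dec)
open import Data.Sum using (_⊎_; inj₁; inj₂)
open import Data.List using (List; []; _∷_; _∷ʳ_; map; filter; applyUpTo)
open import Data.List.Properties using (applyUpTo-∷ʳ; map-applyUpTo)
open import Data.List.Membership.Propositional using (_∈_; lose)
open import Data.List.Membership.Propositional.Properties using (∈-filter⁺; ∈-filter⁻; ∈-applyUpTo⁺; ∈-applyUpTo⁻)
open import Data.List.Relation.Unary.All as All using (All)
import Data.List.Relation.Unary.All.Properties as All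
open import Data.List.Relation.Unary.Any using (Any; here; there)
open import Data.List.Relation.Unary.Unique.Propositional using (Unique; []; _∷_)
import Data.List.Relation.Unary.Unique.Propositional.Properties as Unique
open import Data.List.Extrema.Nat using (argmax; argmax-sel; f[⊥]≤f[argmax]; f[xs]≤f[argmax]; f[argmax]<v⁺)
open import Function using (_∘_)
open import Level using (0ℓ)
open import Relation.Nullary using (¬_; Dec; yes; no; contradiction)
open import Relation.Nullary.Decidable using (_×-dec_; _⊎-dec_)
open import Relation.Unary using (Pred; Decidable)
open import Relation.Binary.Definitions using (DecidableEquality)
open import Relation.Binary.PropositionalEquality
open import Algebra.Properties.CommutativeSemigroup +-commutativeSemigroup using (interchange; xy∙z≈xz∙y)

-- Finite sums and counting

∑< : ℕ → (ℕ → ℕ) → ℕ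
∑< n f = sum (applyUpTo f n)

syntax ∑< n (λ m → e) = ∑[ m < n ] e

∑<-suc : ∀ n (f : ℕ → ℕ) → ∑[ m < suc n ] f m ≡ ∑[ m < n ] f m + f n
∑<-suc n f = begin
  sum (applyUpTo f (suc n))   ≡⟨ cong sum (applyUpTo-∷ʳ f n) ⟨
  sum (applyUpTo f n ∷ʳ f n)  ≡⟨ sum-++ (applyUpTo f n) (f n ∷ []) ⟩
  ∑< n f + (f n + 0)          ≡⟨ cong (∑< n f +_) (+-identityʳ (f n)) ⟩
  ∑< n f + f n                ∎
  where open ≡-Reasoning

∑<-mono-≤ : ∀ n {f g : ℕ → ℕ} → (∀ m → m < n → f m ≤ g m) → ∑< n f ≤ ∑< n g
∑<-mono-≤ zero    f≤g = z≤n
∑<-mono-≤ (suc n) f≤g = +-mono-≤ (f≤g 0 z<s) (∑<-mono-≤ n λ m m<n → f≤g (suc m) (s≤s m<n))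

∑<-cong : ∀ n {f g : ℕ → ℕ} → (∀ m → m < n → f m ≡ g m) → ∑< n f ≡ ∑< n g
∑<-cong zero    f≡g = refl
∑<-cong (suc n) f≡g = cong₂ _+_ (f≡g 0 z<s) (∑<-cong n λ m m<n → f≡g (suc m) (s≤s m<n))

∑<-+ : ∀ n (f g : ℕ → ℕ) → ∑[ m < n ] (f m + g m) ≡ ∑< n f + ∑< n g
∑<-+ zero    f g = refl
∑<-+ (suc n) f g = trans (cong (f 0 + g 0 +_) (∑<-+ n (f ∘ suc) (g ∘ suc))) (interchange (f 0) (g 0) _ _)

∑<-const : ∀ n c → ∑[ m < n ] c ≡ n * c
∑<-const zero    c = refl
∑<-const (suc n) c = cong (c +_) (∑<-const n c)

module _ {A : Set} where

  sum-map-mono-≤ : ∀ (xs : List A) {f g : A → ℕ} → (∀ {x} → x ∈ xs → f x ≤ g x) →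
                   sum (map f xs) ≤ sum (map g xs)
  sum-map-mono-≤ []       f≤g = z≤n
  sum-map-mono-≤ (x ∷ xs) f≤g = +-mono-≤ (f≤g (here refl)) (sum-map-mono-≤ xs (f≤g ∘ there))

  sum-map-cong : ∀ (xs : List A) {f g : A → ℕ} → (∀ {x} → x ∈ xs → f x ≡ g x) →
                 sum (map f xs) ≡ sum (map g xs)
  sum-map-cong []       f≡g = refl
  sum-map-cong (x ∷ xs) f≡g = cong₂ _+_ (f≡g (here refl)) (sum-map-cong xs (f≡g ∘ there))

  sum-map-+ : ∀ (xs : List A) (f g : A → ℕ) →
              sum (map (λ x → f x + g x) xs) ≡ sum (map f xs) + sum (map g xs)
  sum-map-+ []       f g = refl
  sum-map-+ (x ∷ xs) f g = trans (cong (f x + g x +_) (sum-map-+ xs f g)) (interchange (f x) (g x) _ _)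

  sum-map-∑< : ∀ (xs : List A) n (h : A → ℕ → ℕ) →
               sum (map (λ x → ∑[ m < n ] h x m) xs) ≡ ∑[ m < n ] sum (map (λ x → h x m) xs)
  sum-map-∑< []       n h = sym (trans (∑<-const n 0) (*-zeroʳ n))
  sum-map-∑< (x ∷ xs) n h = trans (cong (∑< n (h x) +_) (sum-map-∑< xs n h)) (sym (∑<-+ n (h x) _))

𝟙 : ∀ {P : Set} → Dec P → ℕ
𝟙 (yes _) = 1
𝟙 (no _)  = 0

𝟙-mono : ∀ {P Q : Set} (p : Dec P) (q : Dec Q) → (P → Q) → 𝟙 p ≤ 𝟙 q
𝟙-mono (no _)  q       P⇒Q = z≤n
𝟙-mono (yes _) (yes _) P⇒Q = ≤-refl
𝟙-mono (yes p) (no ¬q) P⇒Q = contradiction (P⇒Q p) ¬q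

𝟙-⊎ : ∀ {P Q R : Set} (p : Dec P) (q : Dec Q) (r : Dec R) → (P → Q ⊎ R) → 𝟙 p ≤ 𝟙 q + 𝟙 r
𝟙-⊎ (no _)  q       r       P⇒Q⊎R = z≤n
𝟙-⊎ (yes _) (yes _) r       P⇒Q⊎R = s≤s z≤n
𝟙-⊎ (yes _) (no _)  (yes _) P⇒Q⊎R = s≤s z≤n
𝟙-⊎ (yes p) (no ¬q) (no ¬r) P⇒Q⊎R with P⇒Q⊎R p
... | inj₁ q = contradiction q ¬q
... | inj₂ r = contradiction r ¬r

∑<-𝟙< : ∀ n x → ∑[ m < n ] 𝟙 (m <? x) ≡ n ⊓ x
∑<-𝟙< zero    x = refl
∑<-𝟙< (suc n) x = trans (∑<-suc n _) (trans (cong (_+ 𝟙 (n <? x)) (∑<-𝟙< n x)) (next (n <? x)))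
  where
  next : (n<x? : Dec (n < x)) → n ⊓ x + 𝟙 n<x? ≡ suc n ⊓ x
  next (yes n<x) rewrite m≤n⇒m⊓n≡m (<⇒≤ n<x) | m≤n⇒m⊓n≡m n<x = +-comm n 1
  next (no  n≮x) rewrite m≥n⇒m⊓n≡n (≮⇒≥ n≮x) | m≥n⇒m⊓n≡n (m≤n⇒m≤1+n (≮⇒≥ n≮x)) = +-identityʳ x

module _ {A : Set} where

  count : ∀ {P : Pred A 0ℓ} → Decidable P → List A → ℕ
  count P? xs = sum (map (𝟙 ∘ P?) xs)

  module _ {P Q : Pred A 0ℓ} (P? : Decidable P) (Q? : Decidable Q) where

    count-mono : ∀ xs → (∀ {x} → x ∈ xs → P x → Q x) → count P? xs ≤ count Q? xs
    count-mono xs P⇒Q = sum-map-mono-≤ xs λ {x} x∈xs → 𝟙-mono (P? x) (Q? x) (P⇒Q x∈xs)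

    count-⊎ : ∀ {R : Pred A 0ℓ} (R? : Decidable R) xs → (∀ {x} → x ∈ xs → P x → Q x ⊎ R x) →
              count P? xs ≤ count Q? xs + count R? xs
    count-⊎ R? xs P⇒Q⊎R = ≤-trans (sum-map-mono-≤ xs λ {x} x∈xs → 𝟙-⊎ (P? x) (Q? x) (R? x) (P⇒Q⊎R x∈xs))
                                   (≤-reflexive (sum-map-+ xs (𝟙 ∘ Q?) (𝟙 ∘ R?)))

  count-none : ∀ {P : Pred A 0ℓ} (P? : Decidable P) xs → (∀ {x} → x ∈ xs → ¬ P x) → count P? xs ≡ 0
  count-none P? []       ¬P = refl
  count-none P? (x ∷ xs) ¬P with P? x
  ... | yes p = contradiction p (¬P (here refl))
  ... | no  _ = count-none P? xs (¬P ∘ there)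

  count-≡≤1 : (_≟ᴬ_ : DecidableEquality A) → ∀ {xs} y → Unique xs → count (_≟ᴬ y) xs ≤ 1
  count-≡≤1 _≟ᴬ_ {[]}     y []           = z≤n
  count-≡≤1 _≟ᴬ_ {x ∷ xs} y (x∉xs ∷ !xs) with x ≟ᴬ y
  ... | no  _    = count-≡≤1 _≟ᴬ_ y !xs
  ... | yes refl = ≤-reflexive (cong suc (count-none (_≟ᴬ y) xs λ z∈xs z≡x → All.lookup x∉xs z∈xs (sym z≡x)))

  sum-map≡∑<-count : ∀ (xs : List A) n (f : A → ℕ) → (∀ {x} → x ∈ xs → f x ≤ n) →
                     sum (map f xs) ≡ ∑[ m < n ] count (λ x → m <? f x) xs
  sum-map≡∑<-count xs n f f≤n = trans
    (sum-map-cong xs λ {x} x∈xs → sym (trans (∑<-𝟙< n (f x)) (m≥n⇒m⊓n≡n (f≤n x∈xs))))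
    (sum-map-∑< xs n λ x m → 𝟙 (m <? f x))

-- Windows of a non-crossing family

windowBound : (m U S : ℕ) → ℕ
windowBound m U S = suc (S ⊓ U) ∸ m

private
  excess : ∀ m x → x < m ⊎ ∃ λ p → x ≡ p + m
  excess m x with x <? m
  ... | yes x<m = inj₁ x<m
  ... | no  x≮m = inj₂ (x ∸ m , sym (m∸n+n≡m (≮⇒≥ x≮m)))

  suc[p+m]∸m : ∀ m p → suc (p + m) ∸ m ≡ suc p
  suc[p+m]∸m m p = m+n∸n≡m (suc p) m

  regroup : ∀ p q m → p + m + (q + m) ≡ p + q + m + m
  regroup = solve-∀

windowBound-split-narrow : ∀ {m U x y} → 2 ≤ m → 1 ≤ x → 1 ≤ y → m ≤ x + y → x + y ≤ U →
                           1 + (windowBound m U x + windowBound m U y) ≤ windowBound m U (x + y)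
windowBound-split-narrow {m} {U} {x} {y} 2≤m 1≤x 1≤y m≤x+y x+y≤U
  rewrite m≤n⇒m⊓n≡m x+y≤U | m≤n⇒m⊓n≡m (m+n≤o⇒m≤o x x+y≤U) | m≤n⇒m⊓n≡m (m+n≤o⇒n≤o x x+y≤U)
  with excess m x | excess m y
... | inj₁ x<m | inj₁ y<m rewrite m≤n⇒m∸n≡0 x<m | m≤n⇒m∸n≡0 y<m = m<n⇒0<n∸m (s≤s m≤x+y)
... | inj₁ x<m | inj₂ (q , refl)
  rewrite m≤n⇒m∸n≡0 x<m | suc[p+m]∸m m q | sym (+-assoc x q m) | suc[p+m]∸m m (x + q) =
  s≤s (+-monoˡ-≤ q 1≤x)
... | inj₂ (p , refl) | inj₁ y<m
  rewrite m≤n⇒m∸n≡0 y<m | suc[p+m]∸m m p | +-identityʳ (suc p) | xy∙z≈xz∙y p m y | suc[p+m]∸m m (p + y) =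
  s≤s (subst (_≤ p + y) (+-comm p 1) (+-monoʳ-≤ p 1≤y))
... | inj₂ (p , refl) | inj₂ (q , refl) = begin
  1 + ((suc (p + m) ∸ m) + (suc (q + m) ∸ m)) ≡⟨ cong₂ (λ u v → 1 + (u + v)) (suc[p+m]∸m m p) (suc[p+m]∸m m q) ⟩
  1 + (suc p + suc q)                         ≡⟨ cong suc (+-suc (suc p) q) ⟩
  suc (suc (suc p + q))                       ≡⟨ cong suc (+-comm 2 (p + q)) ⟩
  suc (p + q + 2)                             ≤⟨ s≤s (+-monoʳ-≤ (p + q) 2≤m) ⟩
  suc (p + q + m)                             ≡⟨ suc[p+m]∸m m (p + q + m) ⟨
  suc (p + q + m + m) ∸ m                     ≡⟨ cong (λ z → suc z ∸ m) (regroup p q m) ⟨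
  suc (p + m + (q + m)) ∸ m                   ∎
  where open ≤-Reasoning

windowBound-split-wide : ∀ {m U x y} → U ≤ x + y → x + y < U + m →
                         windowBound m U x + windowBound m U y ≤ windowBound m U (x + y)
windowBound-split-wide {m} {U} {x} {y} U≤x+y x+y<U+m rewrite m≥n⇒m⊓n≡n U≤x+y with excess m x | excess m y
... | inj₁ x<m | _ rewrite m≤n⇒m∸n≡0 (≤-trans (s≤s (m⊓n≤m x U)) x<m) =
  ∸-monoˡ-≤ m (s≤s (m⊓n≤n y U))
... | inj₂ _ | inj₁ y<m rewrite m≤n⇒m∸n≡0 (≤-trans (s≤s (m⊓n≤m y U)) y<m) | +-identityʳ (windowBound m U x) =
  ∸-monoˡ-≤ m (s≤s (m⊓n≤n x U))
... | inj₂ (p , refl) | inj₂ (q , refl) = begin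
  windowBound m U (p + m) + windowBound m U (q + m) ≤⟨ +-mono-≤ (drop-⊓ (p + m)) (drop-⊓ (q + m)) ⟩
  (suc (p + m) ∸ m) + (suc (q + m) ∸ m)             ≡⟨ cong₂ _+_ (suc[p+m]∸m m p) (suc[p+m]∸m m q) ⟩
  suc p + suc q                                     ≤⟨ m+n≤o⇒m≤o∸n (suc p + suc q) fits ⟩
  suc U ∸ m                                         ∎
  where
  open ≤-Reasoning
  drop-⊓ : ∀ z → windowBound m U z ≤ suc z ∸ m
  drop-⊓ z = ∸-monoˡ-≤ m (s≤s (m⊓n≤m z U))
  fits : suc p + suc q + m ≤ suc U
  fits = begin
    suc p + suc q + m     ≡⟨ cong (λ z → suc z + m) (+-suc p q) ⟩
    suc (suc (p + q + m)) ≤⟨ s≤s (+-cancelʳ-≤ m _ _ (subst (_≤ U + m) (cong suc (regroup p q m)) x+y<U+m)) ⟩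
    suc U                 ∎

cut-width : ∀ {a t b S} → a < t → t < b → a + S ≡ b →
            ∃ λ S₁ → ∃ λ S₂ → a + S₁ ≡ t × t + S₂ ≡ b × S₁ + S₂ ≡ S × 0 < S₁ × 0 < S₂
cut-width {a} a<t t<b a+S≡b with m≤n⇒∃[o]m+o≡n (<⇒≤ a<t) | m≤n⇒∃[o]m+o≡n (<⇒≤ t<b)
... | S₁ , refl | S₂ , refl =
  S₁ , S₂ , refl , refl , +-cancelˡ-≡ a _ _ (trans (sym (+-assoc a S₁ S₂)) (sym a+S≡b)) ,
  +-cancelˡ-< a 0 S₁ (subst (_< a + S₁) (sym (+-identityʳ a)) a<t) ,
  +-cancelˡ-< (a + S₁) 0 S₂ (subst (_< a + S₁ + S₂) (sym (+-identityʳ _)) t<b)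

InWindow : (m U a b : ℕ) → Pred (ℕ × ℕ) 0ℓ
InWindow m U a b (i , j) = a ≤ i × j ≤ b × m + i ≤ j × j ≤ U + i

inWindow? : ∀ m U a b → Decidable (InWindow m U a b)
inWindow? m U a b (i , j) = a ≤? i ×-dec j ≤? b ×-dec m + i ≤? j ×-dec j ≤? U + i

InWindow⇒≤width : ∀ {m U a b S e} → InWindow m U a b e → a + S ≡ b → m ≤ S
InWindow⇒≤width {m} {a = a} {S = S} (a≤i , j≤b , m+i≤j , _) a+S≡b =
  +-cancelˡ-≤ a m S (subst₂ _≤_ (+-comm m a) (sym a+S≡b) (≤-trans (+-monoʳ-≤ m a≤i) (≤-trans m+i≤j j≤b)))

module NonCrossing (L : List (ℕ × ℕ)) (unique : Unique L)
                   (noncross : ∀ {e f} → e ∈ L → f ∈ L → ¬ Cross e f) where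

  private
    LeavesBefore : ℕ → ℕ → Pred (ℕ × ℕ) 0ℓ
    LeavesBefore a b (i , j) = i ≡ a × j < b

    leavesBefore? : ∀ a b → Decidable (LeavesBefore a b)
    leavesBefore? a b (i , j) = i ≟ a ×-dec j <? b

  split : ℕ → ℕ → ℕ
  split a b = proj₂ (argmax proj₂ (a , suc a) (filter (leavesBefore? a b) L))

  split-sel : ∀ a b → split a b ≡ suc a ⊎ (a , split a b) ∈ L
  split-sel a b with argmax proj₂ (a , suc a) (filter (leavesBefore? a b) L)
                   | argmax-sel proj₂ (a , suc a) (filter (leavesBefore? a b) L)
  ... | _ | inj₁ refl = inj₁ refl
  ... | _ | inj₂ p∈   with ∈-filter⁻ (leavesBefore? a b) p∈
  ...   | p∈L , refl , _ = inj₂ p∈L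

  suc≤split : ∀ a b → suc a ≤ split a b
  suc≤split a b = f[⊥]≤f[argmax] {f = proj₂} (a , suc a) (filter (leavesBefore? a b) L)

  split< : ∀ a b → suc a < b → split a b < b
  split< a b a+1<b = f[argmax]<v⁺ a+1<b (All.map proj₂ (All.all-filter (leavesBefore? a b) L))

  ≤split : ∀ a b {j} → (a , j) ∈ L → j < b → j ≤ split a b
  ≤split a b aj∈L j<b = All.lookup (f[xs]≤f[argmax] {f = proj₂} (a , suc a) (filter (leavesBefore? a b) L))
                                   (∈-filter⁺ (leavesBefore? a b) aj∈L (refl , j<b))

  nested : ∀ {a b i j} → (i , j) ∈ L → a ≤ i → j ≤ b → (i , j) ≢ (a , b) →
           j ≤ split a b ⊎ split a b ≤ i
  nested {a} {b} {i} {j} ij∈L a≤i j≤b ij≢ab with m≤n⇒m<n∨m≡n a≤i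
  ... | inj₂ refl = inj₁ (≤split a b ij∈L (≤∧≢⇒< j≤b λ j≡b → ij≢ab (cong (a ,_) j≡b)))
  ... | inj₁ a<i with i <? split a b | j ≤? split a b | split-sel a b
  ...   | no  i≮t | _       | _          = inj₂ (≮⇒≥ i≮t)
  ...   | yes _   | yes j≤t | _          = inj₁ j≤t
  ...   | yes i<t | no  j≰t | inj₁ t≡a+1 = contradiction (≤-pred (subst (i <_) t≡a+1 i<t)) (<⇒≱ a<i)
  ...   | yes i<t | no  j≰t | inj₂ at∈L  = contradiction (inj₁ (a<i , i<t , ≰⇒> j≰t)) (noncross at∈L ij∈L)

  inWindow-split : ∀ {m U a b e} → e ∈ L → InWindow m U a b e → e ≢ (a , b) →
                   InWindow m U a (split a b) e ⊎ InWindow m U (split a b) b e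
  inWindow-split e∈L (a≤i , j≤b , span) e≢ab with nested e∈L a≤i j≤b e≢ab
  ... | inj₁ j≤t = inj₁ (a≤i , j≤t , span)
  ... | inj₂ t≤i = inj₂ (t≤i , j≤b , span)

  module _ (m U : ℕ) where

    windowCount : ℕ → ℕ → ℕ
    windowCount a b = count (inWindow? m U a b) L

    private
      halves? : ∀ a b → Decidable (λ e → InWindow m U a (split a b) e ⊎ InWindow m U (split a b) b e)
      halves? a b e = inWindow? m U a (split a b) e ⊎-dec inWindow? m U (split a b) b e

      halves≤ : ∀ a b → count (halves? a b) L ≤ windowCount a (split a b) + windowCount (split a b) b
      halves≤ a b = count-⊎ (halves? a b) (inWindow? m U a (split a b)) (inWindow? m U (split a b) b) L (λ _ h → h)

    windowCount-split : ∀ a b → windowCount a b ≤ 1 + (windowCount a (split a b) + windowCount (split a b) b)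
    windowCount-split a b = begin
      windowCount a b                                  ≤⟨ count-⊎ (inWindow? m U a b) (_≟ₚ (a , b)) (halves? a b) L outer ⟩
      count (_≟ₚ (a , b)) L + count (halves? a b) L    ≤⟨ +-mono-≤ (count-≡≤1 _≟ₚ_ (a , b) unique) (halves≤ a b) ⟩
      1 + (windowCount a (split a b) + windowCount (split a b) b) ∎
      where
      open ≤-Reasoning
      _≟ₚ_ : DecidableEquality (ℕ × ℕ)
      _≟ₚ_ = ≡-dec _≟_ _≟_
      outer : ∀ {e} → e ∈ L → InWindow m U a b e → e ≡ (a , b) ⊎ _
      outer {e} e∈L w with e ≟ₚ (a , b)
      ... | yes e≡ab = inj₁ e≡ab
      ... | no  e≢ab = inj₂ (inWindow-split e∈L w e≢ab)

    windowCount-split-wide : ∀ a b → U + a < b →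
                             windowCount a b ≤ windowCount a (split a b) + windowCount (split a b) b
    windowCount-split-wide a b U+a<b = ≤-trans (count-mono (inWindow? m U a b) (halves? a b) L inner) (halves≤ a b)
      where
      inner : ∀ {e} → e ∈ L → InWindow m U a b e → _
      inner e∈L w = inWindow-split e∈L w λ { refl → <⇒≱ U+a<b (proj₂ (proj₂ (proj₂ w))) }

    WindowBounded : ℕ → Set
    WindowBounded S = ∀ {a b} → a + S ≡ b → S < U + m → windowCount a b ≤ windowBound m U S

    windowCount≤ : 2 ≤ m → ∀ S → WindowBounded S
    windowCount≤ 2≤m = <-rec WindowBounded bound
      where
      bound : ∀ S → (∀ {S′} → S′ < S → WindowBounded S′) → WindowBounded S
      bound S ih {a} {b} a+S≡b S<U+m with S <? m
      ... | yes S<m = ≤-trans (≤-reflexive (count-none (inWindow? m U a b) L too-short)) z≤n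
        where
        too-short : ∀ {e} → e ∈ L → ¬ InWindow m U a b e
        too-short _ w = <⇒≱ S<m (InWindow⇒≤width w a+S≡b)
      ... | no S≮m with cut-width (suc≤split a b) (split< a b a+1<b) a+S≡b
        where
        a+1<b : suc a < b
        a+1<b = subst (suc a <_) a+S≡b (subst (_≤ a + S) (+-comm a 2) (+-monoʳ-≤ a (≤-trans 2≤m (≮⇒≥ S≮m))))
      ...   | S₁ , S₂ , a+S₁≡t , t+S₂≡b , refl , 0<S₁ , 0<S₂ = combine (S₁ + S₂ ≤? U)
        where
        open ≤-Reasoning
        t = split a b
        ih₁ : windowCount a t ≤ windowBound m U S₁
        ih₁ = ih (m<m+n S₁ 0<S₂) a+S₁≡t (<-trans (m<m+n S₁ 0<S₂) S<U+m)
        ih₂ : windowCount t b ≤ windowBound m U S₂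
        ih₂ = ih (m<n+m S₂ 0<S₁) t+S₂≡b (<-trans (m<n+m S₂ 0<S₁) S<U+m)
        combine : Dec (S₁ + S₂ ≤ U) → windowCount a b ≤ windowBound m U (S₁ + S₂)
        combine (yes S≤U) = begin
          windowCount a b                               ≤⟨ windowCount-split a b ⟩
          1 + (windowCount a t + windowCount t b)       ≤⟨ +-monoʳ-≤ 1 (+-mono-≤ ih₁ ih₂) ⟩
          1 + (windowBound m U S₁ + windowBound m U S₂) ≤⟨ windowBound-split-narrow 2≤m 0<S₁ 0<S₂ (≮⇒≥ S≮m) S≤U ⟩
          windowBound m U (S₁ + S₂)                     ∎
        combine (no S≰U) = begin
          windowCount a b                               ≤⟨ windowCount-split-wide a b U+a<b ⟩
          windowCount a t + windowCount t b             ≤⟨ +-mono-≤ ih₁ ih₂ ⟩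
          windowBound m U S₁ + windowBound m U S₂       ≤⟨ windowBound-split-wide (<⇒≤ (≰⇒> S≰U)) S<U+m ⟩
          windowBound m U (S₁ + S₂)                     ∎
          where
          U+a<b : U + a < b
          U+a<b = subst (U + a <_) (trans (+-comm (S₁ + S₂) a) a+S≡b) (+-monoˡ-< a (≰⇒> S≰U))

-- Chord lengths and the upper bound

chordLength≤ : ∀ n e → chordLength n e ≤ n
chordLength≤ n (i , j) = ≤-trans (m⊓n≤n _ _) (m∸n≤m n (j ∸ i))

2≤chordLength : ∀ {n e} → Chord n e → 2 ≤ chordLength n e
2≤chordLength {n} {i , j} (2+i≤j , j<n , ¬edge) =
  ⊓-glb (m+n≤o⇒m≤o∸n 2 2+i≤j) (m+n≤o⇒m≤o∸n 2 (2+span≤n i 2+i≤j ¬edge))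
  where
  2+span≤n : ∀ i → 2 + i ≤ j → ¬ (i ≡ 0 × suc j ≡ n) → 2 + (j ∸ i) ≤ n
  2+span≤n zero    _     ¬edge = ≤∧≢⇒< j<n λ suc-j≡n → ¬edge (refl , suc-j≡n)
  2+span≤n (suc i) 2+i≤j _     = ≤-trans (s≤s (∸-monoʳ-< z<s (≤-trans (n≤1+n _) (≤-trans (n≤1+n _) 2+i≤j)))) j<n

≤chordLength⇒inWindow : ∀ {n k i j} → i ≤ j → j < n → k ≤ chordLength n (i , j) →
                        InWindow k (n ∸ k) 0 (pred n) (i , j)
≤chordLength⇒inWindow {n} {k} {i} {j} i≤j j<n k≤len =
  z≤n , <⇒≤pred j<n , m≤o∸n⇒m+n≤o k i≤j k≤span ,
  subst (_≤ n ∸ k + i) (m∸n+n≡m i≤j) (+-monoˡ-≤ i span≤n∸k)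
  where
  k≤span : k ≤ j ∸ i
  k≤span = ≤-trans k≤len (m⊓n≤m _ _)
  span≤n∸k : j ∸ i ≤ n ∸ k
  span≤n∸k = m+n≤o⇒m≤o∸n (j ∸ i) (subst (_≤ n) (+-comm k (j ∸ i))
               (m≤o∸n⇒m+n≤o k (≤-trans (m∸n≤m j i) (<⇒≤ j<n)) (≤-trans k≤len (m⊓n≤n _ _))))

pred[n]<n∸[1+m]+[1+m] : ∀ n m → pred n < n ∸ suc m + suc m
pred[n]<n∸[1+m]+[1+m] zero    m = s≤s z≤n
pred[n]<n∸[1+m]+[1+m] (suc n) m = subst (suc n ≤_) (+-comm (suc m) (suc n ∸ suc m)) (m≤n+m∸n (suc n) (suc m))

module _ {n} (G : MOP n) where

  longerThan : ℕ → ℕ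
  longerThan m = count (λ e → m <? chordLength n e) (chords G)

  longerThan≤ : ∀ m → 1 ≤ m → longerThan m ≤ n ∸ suc m ∸ m
  longerThan≤ m 1≤m = begin
    longerThan m                     ≤⟨ count-mono _ (inWindow? (suc m) U 0 (pred n)) (chords G) inside ⟩
    windowCount (suc m) U 0 (pred n) ≤⟨ windowCount≤ (suc m) U (s≤s 1≤m) (pred n) refl (pred[n]<n∸[1+m]+[1+m] n m) ⟩
    windowBound (suc m) U (pred n)   ≤⟨ ∸-monoˡ-≤ (suc m) (s≤s (m⊓n≤n (pred n) U)) ⟩
    n ∸ suc m ∸ m                    ∎
    where
    open ≤-Reasoning
    open NonCrossing (chords G) (distinct G) (noncross G)
    U = n ∸ suc m
    inside : ∀ {e} → e ∈ chords G → m < chordLength n e → InWindow (suc m) U 0 (pred n) e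
    inside e∈G m<len with All.lookup (allChords G) e∈G
    ... | 2+i≤j , j<n , _ = ≤chordLength⇒inWindow (≤-trans (m≤n+m _ 2) 2+i≤j) j<n m<len

  longerThan0≤longerThan1 : longerThan 0 ≤ longerThan 1
  longerThan0≤longerThan1 = count-mono _ _ (chords G) λ e∈G _ → 2≤chordLength (All.lookup (allChords G) e∈G)

  TCL≡∑longerThan : TCL G ≡ ∑[ m < n ] longerThan m
  TCL≡∑longerThan = sum-map≡∑<-count (chords G) n (chordLength n) λ {e} _ → chordLength≤ n e

quarterSquare : ℕ → ℕ
quarterSquare n = ∑[ m < n ] (n ∸ suc m ∸ m)

TCL+2≤quarterSquare : ∀ k (G : MOP (3 + k)) → TCL G + 2 ≤ quarterSquare (3 + k)
TCL+2≤quarterSquare k G = begin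
  TCL G + 2                                                ≡⟨ cong (_+ 2) (TCL≡∑longerThan G) ⟩
  longerThan G 0 + ∑[ m < 2 + k ] longerThan G (suc m) + 2 ≡⟨ xy∙z≈xz∙y (longerThan G 0) _ 2 ⟩
  longerThan G 0 + 2 + ∑[ m < 2 + k ] longerThan G (suc m) ≤⟨ +-mono-≤ layer0 upperLayers ⟩
  quarterSquare (3 + k)                                    ∎
  where
  open ≤-Reasoning
  upperLayers : ∑[ m < 2 + k ] longerThan G (suc m) ≤ ∑[ m < 2 + k ] (3 + k ∸ suc (suc m) ∸ suc m)
  upperLayers = ∑<-mono-≤ (2 + k) λ m _ → longerThan≤ G (suc m) (s≤s z≤n)
  layer0 : longerThan G 0 + 2 ≤ 2 + k
  layer0 = subst (longerThan G 0 + 2 ≤_) (+-comm k 2)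
             (+-monoˡ-≤ 2 (≤-trans (longerThan0≤longerThan1 G) (longerThan≤ G 1 (s≤s z≤n))))

-- The fan and the closed forms

fanChord : ℕ → ℕ × ℕ
fanChord i = 0 , 2 + i

fanChords : ℕ → List (ℕ × ℕ)
fanChords = applyUpTo fanChord

fanChords-noncross : ∀ k {e f} → e ∈ fanChords k → f ∈ fanChords k → ¬ Cross e f
fanChords-noncross k e∈ f∈ with ∈-applyUpTo⁻ fanChord e∈ | ∈-applyUpTo⁻ fanChord f∈
... | _ , _ , refl | _ , _ , refl = λ { (inj₁ (() , _)) ; (inj₂ (() , _)) }

fanChords-maximal : ∀ k e → Chord (3 + k) e → ¬ e ∈ fanChords k → Any (Cross e) (fanChords k)
fanChords-maximal k (zero , j) (2≤j , j<n , ¬edge) e∉ with m≤n⇒∃[o]m+o≡n 2≤j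
... | i , refl = contradiction (∈-applyUpTo⁺ fanChord (+-cancelˡ-< 3 i k (≤∧≢⇒< j<n λ eq → ¬edge (refl , eq)))) e∉
fanChords-maximal k (suc i , j) (3+i≤j , j<n , _) _ =
  lose (∈-applyUpTo⁺ fanChord (+-cancelˡ-< 3 i k (<-≤-trans (s≤s 3+i≤j) j<n))) (inj₂ (z<s , ≤-refl , 3+i≤j))

fanChord-chord : ∀ {k i} → i < k → Chord (3 + k) (fanChord i)
fanChord-chord i<k = s≤s (s≤s z≤n) , s≤s (s≤s (s≤s (<⇒≤ i<k))) , λ (_ , 3+i≡3+k) → <⇒≢ i<k (+-cancelˡ-≡ 3 _ _ 3+i≡3+k)

fan : ∀ k → MOP (3 + k)
fan k = record
  { chords    = fanChords k
  ; allChords = All.applyUpTo⁺₁ fanChord k fanChord-chord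
  ; distinct  = Unique.applyUpTo⁺₁ fanChord k λ i<j _ eq → <⇒≢ i<j (+-cancelˡ-≡ 2 _ _ (cong proj₂ eq))
  ; noncross  = fanChords-noncross k
  ; maximal   = fanChords-maximal k
  }

distanceSum : ℕ → ℕ
distanceSum n = ∑[ j < n ] (j ⊓ (n ∸ j))

TCL-fan : ∀ k → TCL (fan k) + 2 ≡ distanceSum (3 + k)
TCL-fan k = begin
  sum (map (chordLength (3 + k)) (fanChords k)) + 2 ≡⟨ cong (λ xs → sum xs + 2) (map-applyUpTo fanChord _ k) ⟩
  ∑< k len + 2                                      ≡⟨ +-suc _ 1 ⟩
  suc (∑< k len + 1)                                ≡⟨ cong (λ x → suc (∑< k len + x)) len[k]≡1 ⟨
  suc (∑< k len + len k)                            ≡⟨ cong suc (∑<-suc k len) ⟨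
  distanceSum (3 + k)                               ∎
  where
  open ≡-Reasoning
  len : ℕ → ℕ
  len i = (2 + i) ⊓ (3 + k ∸ (2 + i))
  len[k]≡1 : len k ≡ 1
  len[k]≡1 = cong ((2 + k) ⊓_) (m+n∸n≡m 1 k)

distanceSum-+2 : ∀ n → distanceSum (2 + n) ≡ distanceSum n + suc n
distanceSum-+2 n = begin
  ∑[ j < suc n ] (suc j ⊓ (suc n ∸ j)) ≡⟨ ∑<-cong (suc n) shift ⟩
  ∑[ j < suc n ] (1 + g j)             ≡⟨ ∑<-+ (suc n) (λ _ → 1) g ⟩
  ∑[ j < suc n ] 1 + ∑< (suc n) g      ≡⟨ cong₂ _+_ (∑<-const (suc n) 1) (∑<-suc n g) ⟩
  suc n * 1 + (distanceSum n + g n)    ≡⟨ cong₂ (λ x y → x + (distanceSum n + y)) (*-identityʳ (suc n)) g[n]≡0 ⟩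
  suc n + (distanceSum n + 0)          ≡⟨ cong (suc n +_) (+-identityʳ _) ⟩
  suc n + distanceSum n                ≡⟨ +-comm (suc n) _ ⟩
  distanceSum n + suc n                ∎
  where
  open ≡-Reasoning
  g : ℕ → ℕ
  g j = j ⊓ (n ∸ j)
  shift : ∀ j → j < suc n → suc j ⊓ (suc n ∸ j) ≡ 1 + g j
  shift j j<1+n = cong (suc j ⊓_) (+-∸-assoc 1 (≤-pred j<1+n))
  g[n]≡0 : g n ≡ 0
  g[n]≡0 = trans (cong (n ⊓_) (n∸n≡0 n)) (⊓-zeroʳ n)

∸-∸-comm : ∀ n a b → n ∸ a ∸ b ≡ n ∸ b ∸ a
∸-∸-comm n a b = trans (∸-+-assoc n a b) (trans (cong (n ∸_) (+-comm a b)) (sym (∸-+-assoc n b a)))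

quarterSquare-+2 : ∀ n → quarterSquare (2 + n) ≡ quarterSquare n + suc n
quarterSquare-+2 n = begin
  suc n + ∑[ m < suc n ] f m  ≡⟨ cong (suc n +_) (∑<-suc n f) ⟩
  suc n + (∑< n f + f n)      ≡⟨ cong (λ x → suc n + (∑< n f + x)) f[n]≡0 ⟩
  suc n + (∑< n f + 0)        ≡⟨ cong (suc n +_) (+-identityʳ _) ⟩
  suc n + ∑< n f              ≡⟨ cong (suc n +_) (∑<-cong n λ m _ → ∸-∸-comm n m (suc m)) ⟩
  suc n + quarterSquare n     ≡⟨ +-comm (suc n) _ ⟩
  quarterSquare n + suc n     ∎
  where
  open ≡-Reasoning
  f : ℕ → ℕ
  f m = n ∸ m ∸ suc m
  f[n]≡0 : f n ≡ 0
  f[n]≡0 = m≤n⇒m∸n≡0 (≤-trans (m∸n≤m n n) (n≤1+n n))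

[[2+n]²∸c]/4≡[n²∸c]/4+1+n : ∀ n c → c ≤ n * n → ((2 + n) * (2 + n) ∸ c) / 4 ≡ (n * n ∸ c) / 4 + suc n
[[2+n]²∸c]/4≡[n²∸c]/4+1+n n c c≤n*n = begin
  ((2 + n) * (2 + n) ∸ c) / 4      ≡⟨ cong (λ x → (x ∸ c) / 4) (square n) ⟩
  (n * n + suc n * 4 ∸ c) / 4      ≡⟨ cong (_/ 4) (+-∸-comm (suc n * 4) c≤n*n) ⟩
  ((n * n ∸ c) + suc n * 4) / 4    ≡⟨ +-distrib-/-∣ʳ (n * n ∸ c) (divides (suc n) refl) ⟩
  (n * n ∸ c) / 4 + suc n * 4 / 4  ≡⟨ cong ((n * n ∸ c) / 4 +_) (m*n/n≡m (suc n) 4) ⟩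
  (n * n ∸ c) / 4 + suc n          ∎
  where
  open ≡-Reasoning
  square : ∀ n → (2 + n) * (2 + n) ≡ n * n + suc n * 4
  square = solve-∀

-- (2 + n) % 2 reduces to n % 2, so one case split on n % 2 unfolds both sides.
maxTCL-+2 : ∀ n → 3 ≤ n → maxTCL (2 + n) ≡ maxTCL n + suc n
maxTCL-+2 n 3≤n with n % 2
... | zero  = [[2+n]²∸c]/4≡[n²∸c]/4+1+n n 8 (≤-trans (n≤1+n 8) (*-mono-≤ 3≤n 3≤n))
... | suc _ = [[2+n]²∸c]/4≡[n²∸c]/4+1+n n 9 (*-mono-≤ 3≤n 3≤n)

recurrence-unique : ∀ {f g : ℕ → ℕ} k →
  (∀ n → k ≤ n → f (2 + n) ≡ f n + suc n) → (∀ n → k ≤ n → g (2 + n) ≡ g n + suc n) →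
  f k ≡ g k → f (1 + k) ≡ g (1 + k) → ∀ d → f (k + d) ≡ g (k + d)
recurrence-unique {f} {g} k f-rec g-rec f≡g₀ f≡g₁ = agree
  where
  agree : ∀ d → f (k + d) ≡ g (k + d)
  agree zero          = subst (λ x → f x ≡ g x) (sym (+-identityʳ k)) f≡g₀
  agree (suc zero)    = subst (λ x → f x ≡ g x) (+-comm 1 k) f≡g₁
  agree (suc (suc d)) = subst (λ x → f x ≡ g x) (sym (trans (+-suc k (suc d)) (cong suc (+-suc k d)))) (begin
    f (2 + (k + d))         ≡⟨ f-rec (k + d) (m≤m+n k d) ⟩
    f (k + d) + suc (k + d) ≡⟨ cong (_+ suc (k + d)) (agree d) ⟩
    g (k + d) + suc (k + d) ≡⟨ g-rec (k + d) (m≤m+n k d) ⟨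
    g (2 + (k + d))         ∎)
    where open ≡-Reasoning

distanceSum≡quarterSquare : ∀ n → distanceSum n ≡ quarterSquare n
distanceSum≡quarterSquare = recurrence-unique 0 (λ n _ → distanceSum-+2 n) (λ n _ → quarterSquare-+2 n) refl refl

quarterSquare≡maxTCL+2 : ∀ k → quarterSquare (3 + k) ≡ maxTCL (3 + k) + 2
quarterSquare≡maxTCL+2 = recurrence-unique 3 (λ n _ → quarterSquare-+2 n) maxTCL+2-rec refl refl
  where
  maxTCL+2-rec : ∀ n → 3 ≤ n → maxTCL (2 + n) + 2 ≡ maxTCL n + 2 + suc n
  maxTCL+2-rec n 3≤n = trans (cong (_+ 2) (maxTCL-+2 n 3≤n)) (xy∙z≈xz∙y (maxTCL n) (suc n) 2)

theorem2 : (n : ℕ) → 5 ≤ n →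
    Σ (MOP n) (λ G → TCL G ≡ maxTCL n) × ((G : MOP n) → TCL G ≤ maxTCL n)
theorem2 n 5≤n with m≤n⇒∃[o]m+o≡n (≤-trans (s≤s (s≤s (s≤s z≤n))) 5≤n)
... | k , refl = (fan k , +-cancelʳ-≡ 2 _ _ fan-attains) , λ G → +-cancelʳ-≤ 2 _ _ (upper G)
  where
  fan-attains : TCL (fan k) + 2 ≡ maxTCL (3 + k) + 2
  fan-attains = trans (TCL-fan k) (trans (distanceSum≡quarterSquare (3 + k)) (quarterSquare≡maxTCL+2 k))
  upper : (G : MOP (3 + k)) → TCL G + 2 ≤ maxTCL (3 + k) + 2
  upper G = subst (TCL G + 2 ≤_) (quarterSquare≡maxTCL+2 k) (TCL+2≤quarterSquare k G)
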